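{- The set of type $E_7$ tropical strong exchange polynomials, namely $f^{E_7}_{A,B}=x_A\odot x_B\oplus\bigoplus_{i=1}^5x_{C_i}\odot x_{C_i'}$ for every pair $(A,B)$ of vertices of $3_{21}$ at edge-distance $2$, together with $f^{E_7}=\bigoplus_{A}x_A\odot x_{ -A}$, is affinely invariant (as tropical polynomials in variables indexed by the vertices of $3_{21}$).
   Context: $W=W(E_7)$, $P$ the minuscule maximal parabolic subgroup, $3_{21}=\Delta(E_7/P)$ the convex hull of the $W$-orbit of a point with stabilizer $P$; it is 7-dimensional with 56 vertices, any two at edge-distance at most 3. Each pair $(A,B)$ at edge-distance $2$ spans a 6-dimensional cross-polytope face with antipodal vertex pairs $(A,B),(C_1,C_1'),\dots,(C_5,C_5')$; for each vertex $A$ there is a unique vertex $-A$ at edge-distance $3$. $\mathbb{T}=\mathbb{R}\cup\{\infty\}$, $\oplus=\min$, $\odot=+$; $\nu\in V^{\mathrm{trop}}(f)$ means the minimum of the monomials of $f$ at $\nu$ is $\infty$ or attained at least twice. A set $\mathcal{F}$ of tropical polynomials in variables indexed by a finite $E\subset\mathbb{R}^m$ is affinely invariant if for all $\mu\colon E\to\mathbb{T}$ and all affine linear $\varphi\colon\mathbb{R}^m\to\mathbb{R}$, $\mu\in\bigcap_{f\in\mathcal{F}}V^{\mathrm{trop}}(f)$ iff $\mu+\varphi|_E\in\bigcap_{f\in\mathcal{F}}V^{\mathrm{trop}}(f)$. -}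

module Defs where

open import Level using (0ℓ)
open import Data.Nat as ℕ using (ℕ; zero; suc)
open import Data.Integer as ℤ using (ℤ; +_; -[1+_])
open import Data.Fin using (Fin; zero; suc; splitAt; #_)
open import Data.Fin.Properties using (_≟_)
open import Data.Vec using (Vec; _∷_; []; lookup)
open import Data.Product using (Σ; ∃; ∃-syntax; _×_; _,_; proj₁; proj₂)
open import Data.Sum using (_⊎_; inj₁; inj₂)
open import Data.Unit using (⊤)
open import Data.Empty using (⊥)
open import Relation.Nullary using (¬_; yes; no)
open import Relation.Binary.PropositionalEquality using (_≡_; _≢_)
open import Relation.Binary.Structures using (IsTotalOrder)
open import Algebra.Structures using (IsCommutativeRing)
open import Function.Bundles using (_⇔_)

-- The real numbers, axiomatised as a Dedekind-complete ordered field
-- (any model is isomorphic to ℝ).  The statement quantifies over all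
-- models.

record RealField : Set₁ where
  infixl 6 _+_
  infixl 7 _*_
  infix 4 _≤_
  field
    Carrier : Set
    _+_ _*_ : Carrier → Carrier → Carrier
    -_      : Carrier → Carrier
    0# 1#   : Carrier
    _≤_     : Carrier → Carrier → Set
    isCommutativeRing : IsCommutativeRing _≡_ _+_ _*_ -_ 0# 1#
    0≢1     : 0# ≢ 1#
    inverse : ∀ x → x ≢ 0# → ∃[ y ] (x * y ≡ 1#)
    isTotalOrder : IsTotalOrder _≡_ _≤_
    +-mono-≤ : ∀ {x y} z → x ≤ y → x + z ≤ y + z
    *-nonneg : ∀ {x y} → 0# ≤ x → 0# ≤ y → 0# ≤ x * y
    complete : (S : Carrier → Set) → ∃ S →
               (∃[ b ] (∀ x → S x → x ≤ b)) →
               ∃[ s ] ((∀ x → S x → x ≤ s) ×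
                       (∀ b → (∀ x → S x → x ≤ b) → s ≤ b))

module Tropical (R : RealField) where
  open RealField R

  data 𝕋 : Set where
    fin : Carrier → 𝕋
    ∞   : 𝕋

  _⊙_ : 𝕋 → 𝕋 → 𝕋
  fin a ⊙ fin b = fin (a + b)
  fin _ ⊙ ∞     = ∞
  ∞     ⊙ _     = ∞

  -- order on 𝕋 (∞ is the top element); ⊕ = min w.r.t. this order
  data _≤T_ : 𝕋 → 𝕋 → Set where
    fin≤fin : ∀ {a b} → a ≤ b → fin a ≤T fin b
    _≤∞     : ∀ t → t ≤T ∞

  tpow : ℕ → 𝕋 → 𝕋
  tpow zero    _ = fin 0#
  tpow (suc k) t = t ⊙ tpow k t

  tprod : ∀ {n} → (Fin n → 𝕋) → 𝕋
  tprod {zero}  _ = fin 0#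
  tprod {suc n} g = g zero ⊙ tprod (λ i → g (suc i))

  rsum : ∀ {m} → (Fin m → Carrier) → Carrier
  rsum {zero}  _ = 0#
  rsum {suc m} g = g zero + rsum (λ i → g (suc i))

  Exp : ℕ → Set
  Exp n = Fin n → ℕ

  -- A tropical polynomial in variables x_v (v : Fin n): a set of
  -- monomials (given by their exponent vectors) with real coefficients.
  -- f = ⨁_{e ∈ Mon} coeff e ⊙ x^e.
  record TropPoly (n : ℕ) : Set₁ where
    field
      Mon   : Exp n → Set
      coeff : Exp n → Carrier
  open TropPoly public

  monVal : ∀ {n} → TropPoly n → Exp n → (Fin n → 𝕋) → 𝕋
  monVal f e ν = fin (coeff f e) ⊙ tprod (λ v → tpow (e v) (ν v))

  InVtrop : ∀ {n} → TropPoly n → (Fin n → 𝕋) → Set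
  InVtrop f ν =
    (∀ e → Mon f e → monVal f e ν ≡ ∞)
    ⊎ ∃[ e₁ ] ∃[ e₂ ] (Mon f e₁ × Mon f e₂ × ¬ (∀ v → e₁ v ≡ e₂ v)
        × monVal f e₁ ν ≡ monVal f e₂ ν
        × (∀ e → Mon f e → monVal f e₁ ν ≤T monVal f e ν))

  -- μ + φ|_E for the affine map φ(x) = c + Σ_j a_j x_j on ℝ^m, where the
  -- variable v corresponds to the point pt v ∈ E ⊂ ℝ^m.
  affShift : ∀ {n m} → (Fin n → Fin m → Carrier) → (Fin n → 𝕋) →
             (Fin m → Carrier) → Carrier → (Fin n → 𝕋)
  affShift pt μ a c v = μ v ⊙ fin (c + rsum (λ j → a j * pt v j))

  AffinelyInvariant : ∀ {n m} → (Fin n → Fin m → Carrier) →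
                      {I : Set} → (I → TropPoly n) → Set
  AffinelyInvariant pt {I} F =
    ∀ (μ : Fin _ → 𝕋) (a : Fin _ → Carrier) (c : Carrier) →
      (∀ i → InVtrop (F i) μ) ⇔ (∀ i → InVtrop (F i) (affShift pt μ a c))

-- Model: weight space of E_7 realised as the hyperplane Σ x_j = 0 in ℝ^8
-- (E_7 ⊃ SL_8, 56 = Λ²V ⊕ Λ²V*).  The minuscule weights are, scaled by 4,
--   4(e_i + e_j) − 𝟙   and   𝟙 − 4(e_i + e_j)     (i < j).
-- Vertices are indexed by Fin 56 = Fin (28 + 28).

pairs : Vec (Fin 8 × Fin 8) 28
pairs = (# 0 , # 1) ∷ (# 0 , # 2) ∷ (# 0 , # 3) ∷ (# 0 , # 4) ∷ (# 0 , # 5) ∷ (# 0 , # 6) ∷ (# 0 , # 7) ∷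
        (# 1 , # 2) ∷ (# 1 , # 3) ∷ (# 1 , # 4) ∷ (# 1 , # 5) ∷ (# 1 , # 6) ∷ (# 1 , # 7) ∷
        (# 2 , # 3) ∷ (# 2 , # 4) ∷ (# 2 , # 5) ∷ (# 2 , # 6) ∷ (# 2 , # 7) ∷
        (# 3 , # 4) ∷ (# 3 , # 5) ∷ (# 3 , # 6) ∷ (# 3 , # 7) ∷
        (# 4 , # 5) ∷ (# 4 , # 6) ∷ (# 4 , # 7) ∷
        (# 5 , # 6) ∷ (# 5 , # 7) ∷
        (# 6 , # 7) ∷ []

Vertex : Set
Vertex = Fin 56

posCoord : Fin 8 × Fin 8 → Fin 8 → ℤ
posCoord (i , k) j with j ≟ i | j ≟ k
... | yes _ | _     = + 3
... | no _  | yes _ = + 3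
... | no _  | no _  = -[1+ 0 ]

coord : Vertex → Fin 8 → ℤ
coord v j with splitAt 28 v
... | inj₁ p = posCoord (lookup pairs p) j
... | inj₂ p = ℤ.- posCoord (lookup pairs p) j

zsum : ∀ {m} → (Fin m → ℤ) → ℤ
zsum {zero}  _ = + 0
zsum {suc m} g = g zero ℤ.+ zsum (λ i → g (suc i))

dist² : Vertex → Vertex → ℤ
dist² A B = zsum (λ j → (coord A j ℤ.- coord B j) ℤ.* (coord A j ℤ.- coord B j))

-- Edges of 3_21: A − B is a root of E_7, i.e. |A − B|² equals the
-- squared root length (32 in this scaling); these are exactly the pairs
-- of vertices at minimal distance.
Adjacent : Vertex → Vertex → Set
Adjacent A B = dist² A B ≡ + 32

EdgeDist2 : Vertex → Vertex → Set
EdgeDist2 A B = A ≢ B × ¬ Adjacent A B × ∃[ C ] (Adjacent A C × Adjacent C B)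

EdgeDist3 : Vertex → Vertex → Set
EdgeDist3 A B = A ≢ B × ¬ Adjacent A B
  × ¬ (∃[ C ] (Adjacent A C × Adjacent C B))
  × ∃[ C ] ∃[ D ] (Adjacent A C × Adjacent C D × Adjacent D B)

-- vertex set of the cross-polytope face spanned by A, B at edge-distance 2:
-- A, B and their common neighbours
InFace : Vertex → Vertex → Vertex → Set
InFace A B X = (X ≡ A) ⊎ (X ≡ B) ⊎ (Adjacent A X × Adjacent X B)

-- antipodal vertex pairs of that cross-polytope (non-adjacent distinct
-- vertices of the face); they are (A,B), (C₁,C₁'), …, (C₅,C₅')
AntipodalInFace : Vertex → Vertex → Vertex → Vertex → Set
AntipodalInFace A B X Y = InFace A B X × InFace A B Y × X ≢ Y × ¬ Adjacent X Y

δ : Vertex → Vertex → ℕ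
δ X v with v ≟ X
... | yes _ = 1
... | no _  = 0

pairExp : Vertex → Vertex → Vertex → ℕ
pairExp X Y v = δ X v ℕ.+ δ Y v

module E7 (R : RealField) where
  open RealField R
  open Tropical R

  fromℕ : ℕ → Carrier
  fromℕ zero    = 0#
  fromℕ (suc n) = 1# + fromℕ n

  fromℤ : ℤ → Carrier
  fromℤ (+ n)      = fromℕ n
  fromℤ -[1+ n ]   = - fromℕ (suc n)

  pt : Vertex → Fin 8 → Carrier
  pt v j = fromℤ (coord v j)

  fAB : Vertex → Vertex → TropPoly 56
  Mon   (fAB A B) e = ∃[ X ] ∃[ Y ] (AntipodalInFace A B X Y × (∀ v → e v ≡ pairExp X Y v))
  coeff (fAB A B) _ = 0#

  -- f^{E7} = ⨁_A x_A ⊙ x_{-A}, −A the vertex at edge-distance 3 from A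
  fE7 : TropPoly 56
  Mon   fE7 e = ∃[ A ] ∃[ B ] (EdgeDist3 A B × (∀ v → e v ≡ pairExp A B v))
  coeff fE7 _ = 0#

  Index : Set
  Index = (∃[ A ] ∃[ B ] EdgeDist2 A B) ⊎ ⊤

  family : Index → TropPoly 56
  family (inj₁ (A , B , _)) = fAB A B
  family (inj₂ _)           = fE7

-- Every monomial of f^{E7}_{A,B} is x_X ⊙ x_Y for an antipodal pair (X, Y) of the
-- cross-polytope face spanned by A and B, and every monomial of f^{E7} is x_A ⊙ x_{-A}.
-- In the second case X + Y = 0; in the first X + Y = A + B, because X, A, Y, B is a
-- quadrilateral with four sides of squared length 32 and a diagonal AB of squared
-- length 64: by Euler's quadrilateral theorem its diagonals bisect each other once XY
-- also has squared length 64, and the only other possibility, 96, would give the two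
-- midpoints a negative squared distance.  So within each polynomial all monomials have
-- the same X + Y, and an affine φ = c + ⟨a, -⟩ adds the same constant 2c + ⟨a, X + Y⟩
-- to each of them, which changes neither where the minimum is attained nor whether it
-- is ∞.  The metric facts about the 56 vertices are checked by exhaustive evaluation.

module Submission where

open import Defs
open import Level using (0ℓ)
open import Data.Nat as ℕ using (ℕ; zero; suc; z≤n)
import Data.Nat.Properties as ℕP
open import Data.Fin using (Fin; zero; suc)
open import Data.Fin.Properties using (_≟_; suc-injective; any?; all?)
open import Data.Integer as ℤ using (ℤ; +_; -[1+_]; 0ℤ; +≤+; ∣_∣; _⊖_)
import Data.Integer.Properties as ℤP
open import Data.Integer.Tactic.RingSolver using (solve-∀)
open import Data.Product using (∃-syntax; Σ-syntax; _×_; _,_; proj₂)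
open import Data.Sum using (inj₁; inj₂; reduce)
open import Data.Empty using (⊥-elim)
open import Function.Base using (_∘_)
open import Function.Bundles using (_⇔_; mk⇔; Equivalence)
open import Relation.Nullary using (¬_; Dec; yes; no; ¬?)
open import Relation.Nullary.Decidable using (_×-dec_; _⊎-dec_; map′; toWitness)
open import Relation.Binary.PropositionalEquality
open import Algebra.Bundles using (CommutativeRing; CommutativeMonoid)
open import Algebra.Structures.Biased using (isCommutativeMonoidˡ)
import Algebra.Properties.CommutativeMonoid.Sum as MonoidSum
import Algebra.Properties.CommutativeSemigroup as CommutativeSemigroupProperties
import Algebra.Properties.AbelianGroup as AbelianGroupProperties
import Relation.Binary.PropositionalEquality.Algebra as ≡-Algebra

module _ where
  open import Data.Integer using (_+_; _-_; _*_; _≤_)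
  open MonoidSum ℤP.+-0-commutativeMonoid using (sum; ∑-distrib-+; sum-cong-≗)

  square : ℤ → ℤ
  square i = i * i

  ‖_‖² : ∀ {m} → (Fin m → ℤ) → ℤ
  ‖ x ‖² = zsum (λ j → square (x j))

  d² : ∀ {m} → (Fin m → ℤ) → (Fin m → ℤ) → ℤ
  d² x y = ‖ (λ j → x j - y j) ‖²

  zsum≡sum : ∀ {m} (f : Fin m → ℤ) → zsum f ≡ sum f
  zsum≡sum {zero}  f = refl
  zsum≡sum {suc m} f = cong (_+_ (f zero)) (zsum≡sum (f ∘ suc))

  zsum-cong : ∀ {m} {f g : Fin m → ℤ} → (∀ j → f j ≡ g j) → zsum f ≡ zsum g
  zsum-cong {f = f} {g} f≗g = trans (zsum≡sum f) (trans (sum-cong-≗ f≗g) (sym (zsum≡sum g)))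

  zsum-+ : ∀ {m} (f g : Fin m → ℤ) → zsum (λ j → f j + g j) ≡ zsum f + zsum g
  zsum-+ f g = trans (zsum≡sum (λ j → f j + g j))
    (trans (∑-distrib-+ f g) (sym (cong₂ _+_ (zsum≡sum f) (zsum≡sum g))))

  square≡+∣∣*∣∣ : ∀ i → square i ≡ + (∣ i ∣ ℕ.* ∣ i ∣)
  square≡+∣∣*∣∣ (+ n)    = ℤP.+◃n≡+n _
  square≡+∣∣*∣∣ -[1+ n ] = ℤP.+◃n≡+n _

  square-nonneg : ∀ i → 0ℤ ≤ square i
  square-nonneg i = subst (0ℤ ≤_) (sym (square≡+∣∣*∣∣ i)) (+≤+ z≤n)

  square≡0⇒≡0 : ∀ i → square i ≡ 0ℤ → i ≡ 0ℤ
  square≡0⇒≡0 i eq = reduce (ℤP.i*j≡0⇒i≡0∨j≡0 i eq)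

  nonneg-+≡0⇒≡0 : ∀ {i j} → 0ℤ ≤ i → 0ℤ ≤ j → i + j ≡ 0ℤ → i ≡ 0ℤ × j ≡ 0ℤ
  nonneg-+≡0⇒≡0 {+ m} (+≤+ _) (+≤+ _) eq =
    cong +_ (ℕP.m+n≡0⇒m≡0 m (ℤP.+-injective eq)) , cong +_ (ℕP.m+n≡0⇒n≡0 m (ℤP.+-injective eq))

  ‖‖²-nonneg : ∀ {m} (x : Fin m → ℤ) → 0ℤ ≤ ‖ x ‖²
  ‖‖²-nonneg {zero}  x = +≤+ z≤n
  ‖‖²-nonneg {suc m} x = ℤP.+-mono-≤ (square-nonneg (x zero)) (‖‖²-nonneg (x ∘ suc))

  ‖‖²≡0⇒≡0 : ∀ {m} (x : Fin m → ℤ) → ‖ x ‖² ≡ 0ℤ → ∀ j → x j ≡ 0ℤ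
  ‖‖²≡0⇒≡0 {suc m} x eq j with nonneg-+≡0⇒≡0 (square-nonneg (x zero)) (‖‖²-nonneg (x ∘ suc)) eq | j
  ... | x₀²≡0 , _     | zero   = square≡0⇒≡0 (x zero) x₀²≡0
  ... | _     , rest≡0 | suc j′ = ‖‖²≡0⇒≡0 (x ∘ suc) rest≡0 j′

  d²-sym : ∀ {m} (x y : Fin m → ℤ) → d² x y ≡ d² y x
  d²-sym x y = zsum-cong (λ j → square-sym (x j) (y j))
    where
    square-sym : ∀ u w → (u - w) * (u - w) ≡ (w - u) * (w - u)
    square-sym = solve-∀

  -- Euler's quadrilateral theorem for the quadrilateral a x b y with diagonals xy and
  -- ab: (x + y) - (a + b) is twice the vector joining the midpoints of the diagonals.
  euler-quadrilateral : ∀ {m} (x y a b : Fin m → ℤ) →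
    ‖ (λ j → (x j + y j) - (a j + b j)) ‖² + (d² x y + d² a b)
      ≡ (d² a x + d² x b) + (d² a y + d² y b)
  euler-quadrilateral {m} x y a b = begin
    ‖ s ‖² + (d² x y + d² a b)
      ≡⟨ cong (_+_ ‖ s ‖²) (sym (zsum-+ {m} _ _)) ⟩
    ‖ s ‖² + zsum (λ j → square (x j - y j) + square (a j - b j))
      ≡⟨ sym (zsum-+ {m} _ _) ⟩
    zsum (λ j → square (s j) + (square (x j - y j) + square (a j - b j)))
      ≡⟨ zsum-cong {m} (λ j → pointwise (x j) (y j) (a j) (b j)) ⟩
    zsum (λ j → (square (a j - x j) + square (x j - b j)) + (square (a j - y j) + square (y j - b j)))
      ≡⟨ zsum-+ {m} _ _ ⟩
    zsum (λ j → square (a j - x j) + square (x j - b j)) + zsum (λ j → square (a j - y j) + square (y j - b j))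
      ≡⟨ cong₂ _+_ (zsum-+ {m} _ _) (zsum-+ {m} _ _) ⟩
    (d² a x + d² x b) + (d² a y + d² y b) ∎
    where
    open ≡-Reasoning
    s : Fin m → ℤ
    s j = (x j + y j) - (a j + b j)
    pointwise : ∀ x y a b →
      ((x + y) - (a + b)) * ((x + y) - (a + b)) + ((x - y) * (x - y) + (a - b) * (a - b))
        ≡ ((a - x) * (a - x) + (x - b) * (x - b)) + ((a - y) * (a - y) + (y - b) * (y - b))
    pointwise = solve-∀

CommonNeighbour : Vertex → Vertex → Set
CommonNeighbour A B = ∃[ C ] (Adjacent A C × Adjacent C B)

data Position (A B : Vertex) : Set where
  equal     : A ≡ B → Position A B
  adjacent  : Adjacent A B → Position A B
  distance2 : dist² A B ≡ + 64 → CommonNeighbour A B → Position A B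
  opposite  : dist² A B ≡ + 96 → ¬ CommonNeighbour A B →
              (∀ j → coord A j ℤ.+ coord B j ≡ 0ℤ) → Position A B

-- d² (coord A) (coord B) is dist² A B; going through `square` lets evaluation share
-- each coordinate difference, which halves the cost of the exhaustive check below.
adjacent? : ∀ A B → Dec (Adjacent A B)
adjacent? A B = d² (coord A) (coord B) ℤ.≟ + 32

commonNeighbour? : ∀ A B → Dec (CommonNeighbour A B)
commonNeighbour? A B = any? λ C → adjacent? A C ×-dec adjacent? C B

position? : ∀ A B → Dec (Position A B)
position? A B = map′
  (λ { (inj₁ A≡B)                        → equal A≡B
     ; (inj₂ (inj₁ adj))                 → adjacent adj
     ; (inj₂ (inj₂ (inj₁ (d , c))))      → distance2 d c
     ; (inj₂ (inj₂ (inj₂ (d , ¬c , s)))) → opposite d ¬c s })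
  (λ { (equal A≡B)       → inj₁ A≡B
     ; (adjacent adj)    → inj₂ (inj₁ adj)
     ; (distance2 d c)   → inj₂ (inj₂ (inj₁ (d , c)))
     ; (opposite d ¬c s) → inj₂ (inj₂ (inj₂ (d , ¬c , s))) })
  (A ≟ B ⊎-dec adjacent? A B
    ⊎-dec (d² (coord A) (coord B) ℤ.≟ + 64 ×-dec commonNeighbour? A B)
    ⊎-dec (d² (coord A) (coord B) ℤ.≟ + 96 ×-dec ¬? (commonNeighbour? A B)
             ×-dec all? λ j → coord A j ℤ.+ coord B j ℤ.≟ 0ℤ))

-- Opaque, since unfolding `position A B` would rerun the whole check.
opaque
  position : ∀ A B → Position A B
  position = toWitness {a? = all? λ A → all? λ B → position? A B} _

adjacent-sym : ∀ A B → Adjacent A B → Adjacent B A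
adjacent-sym A B adj = trans (d²-sym (coord B) (coord A)) adj

edgeDist2⇒dist²≡64 : ∀ A B → EdgeDist2 A B → dist² A B ≡ + 64
edgeDist2⇒dist²≡64 A B (A≢B , ¬adj , common) with position A B
... | equal A≡B       = ⊥-elim (A≢B A≡B)
... | adjacent adj    = ⊥-elim (¬adj adj)
... | distance2 d _   = d
... | opposite _ ¬c _ = ⊥-elim (¬c common)

edgeDist3⇒coordSum≡0 : ∀ A B → EdgeDist3 A B → ∀ j → coord A j ℤ.+ coord B j ≡ 0ℤ
edgeDist3⇒coordSum≡0 A B (A≢B , ¬adj , ¬common , _) with position A B
... | equal A≡B      = ⊥-elim (A≢B A≡B)
... | adjacent adj   = ⊥-elim (¬adj adj)
... | distance2 _ c  = ⊥-elim (¬common c)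
... | opposite _ _ s = s

commonNeighbours⇒coordSum≡ : ∀ A B X Y → dist² A B ≡ + 64 →
  Adjacent A X → Adjacent X B → Adjacent A Y → Adjacent Y B → X ≢ Y → ¬ Adjacent X Y →
  ∀ j → coord X j ℤ.+ coord Y j ≡ coord A j ℤ.+ coord B j
commonNeighbours⇒coordSum≡ A B X Y dAB AX XB AY YB X≢Y ¬adj = from-position (position X Y)
  where
  open AbelianGroupProperties ℤP.+-0-abelianGroup using (∙-cancelʳ)
  s : Fin 8 → ℤ
  s j = (coord X j ℤ.+ coord Y j) ℤ.- (coord A j ℤ.+ coord B j)
  sides : ∀ {δ} → dist² X Y ≡ δ → ‖ s ‖² ℤ.+ (δ ℤ.+ + 64) ≡ + 128
  sides refl = trans (cong (λ δ → ‖ s ‖² ℤ.+ (dist² X Y ℤ.+ δ)) (sym dAB))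
    (trans (euler-quadrilateral (coord X) (coord Y) (coord A) (coord B))
           (cong₂ ℤ._+_ (cong₂ ℤ._+_ AX XB) (cong₂ ℤ._+_ AY YB)))
  from-position : Position X Y → ∀ j → coord X j ℤ.+ coord Y j ≡ coord A j ℤ.+ coord B j
  from-position (equal X≡Y)         = ⊥-elim (X≢Y X≡Y)
  from-position (adjacent adj)      = ⊥-elim (¬adj adj)
  from-position (distance2 dXY _) j =
    ℤP.i-j≡0⇒i≡j _ _ (‖‖²≡0⇒≡0 s (∙-cancelʳ (+ 128) _ _ (sides dXY)) j)
  from-position (opposite dXY _ _) with ∙-cancelʳ (+ 160) _ -[1+ 31 ] (sides dXY)
  ... | ‖s‖²≡-32 with subst (0ℤ ℤ.≤_) ‖s‖²≡-32 (‖‖²-nonneg s)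
  ... | ()

antipodalInFace⇒coordSum≡ : ∀ A B X Y → EdgeDist2 A B → AntipodalInFace A B X Y →
  ∀ j → coord X j ℤ.+ coord Y j ≡ coord A j ℤ.+ coord B j
antipodalInFace⇒coordSum≡ A B X Y _ (inj₁ refl , inj₁ refl , X≢Y , _)                   = ⊥-elim (X≢Y refl)
antipodalInFace⇒coordSum≡ A B X Y _ (inj₁ refl , inj₂ (inj₁ refl) , _)                   = λ j → refl
antipodalInFace⇒coordSum≡ A B X Y _ (inj₁ refl , inj₂ (inj₂ (AY , _)) , _ , ¬adj)        = ⊥-elim (¬adj AY)
antipodalInFace⇒coordSum≡ A B X Y _ (inj₂ (inj₁ refl) , inj₁ refl , _)                   =
  λ j → ℤP.+-comm (coord B j) (coord A j)
antipodalInFace⇒coordSum≡ A B X Y _ (inj₂ (inj₁ refl) , inj₂ (inj₁ refl) , X≢Y , _)      = ⊥-elim (X≢Y refl)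
antipodalInFace⇒coordSum≡ A B X Y _ (inj₂ (inj₁ refl) , inj₂ (inj₂ (_ , YB)) , _ , ¬adj) =
  ⊥-elim (¬adj (adjacent-sym Y B YB))
antipodalInFace⇒coordSum≡ A B X Y _ (inj₂ (inj₂ (AX , _)) , inj₁ refl , _ , ¬adj)        =
  ⊥-elim (¬adj (adjacent-sym A X AX))
antipodalInFace⇒coordSum≡ A B X Y _ (inj₂ (inj₂ (_ , XB)) , inj₂ (inj₁ refl) , _ , ¬adj) = ⊥-elim (¬adj XB)
antipodalInFace⇒coordSum≡ A B X Y d₂ (inj₂ (inj₂ (AX , XB)) , inj₂ (inj₂ (AY , YB)) , X≢Y , ¬adj) =
  commonNeighbours⇒coordSum≡ A B X Y (edgeDist2⇒dist²≡64 A B d₂) AX XB AY YB X≢Y ¬adj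

δ-self : ∀ X → δ X X ≡ 1
δ-self X with X ≟ X
... | yes _  = refl
... | no X≢X = ⊥-elim (X≢X refl)

δ-other : ∀ {X v} → v ≢ X → δ X v ≡ 0
δ-other {X} {v} v≢X with v ≟ X
... | yes v≡X = ⊥-elim (v≢X v≡X)
... | no _    = refl

module _ (R : RealField) where
  open RealField R
  open Tropical R
  open E7 R

  ℝ : CommutativeRing 0ℓ 0ℓ
  ℝ = record { isCommutativeRing = isCommutativeRing }

  open CommutativeRing ℝ using (+-assoc; +-comm; +-identityˡ; +-identityʳ; -‿inverseʳ; distribˡ)
  open CommutativeSemigroupProperties (CommutativeRing.+-commutativeSemigroup ℝ)
    using () renaming (interchange to +-interchange)
  open AbelianGroupProperties (CommutativeRing.+-abelianGroup ℝ) using (⁻¹-∙-comm; ε⁻¹≈ε)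
  module ℝΣ = MonoidSum (CommutativeRing.+-commutativeMonoid ℝ)

  rsum≡sum : ∀ {m} (f : Fin m → Carrier) → rsum f ≡ ℝΣ.sum f
  rsum≡sum {zero}  f = refl
  rsum≡sum {suc m} f = cong (_+_ (f zero)) (rsum≡sum (f ∘ suc))

  rsum-+ : ∀ {m} (f g : Fin m → Carrier) → rsum (λ j → f j + g j) ≡ rsum f + rsum g
  rsum-+ f g = trans (rsum≡sum (λ j → f j + g j))
    (trans (ℝΣ.∑-distrib-+ f g) (sym (cong₂ _+_ (rsum≡sum f) (rsum≡sum g))))

  rsum-cong : ∀ {m} {f g : Fin m → Carrier} → (∀ j → f j ≡ g j) → rsum f ≡ rsum g
  rsum-cong {f = f} {g} f≗g = trans (rsum≡sum f) (trans (ℝΣ.sum-cong-≗ f≗g) (sym (rsum≡sum g)))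

  ⊙-assoc : ∀ s t u → (s ⊙ t) ⊙ u ≡ s ⊙ (t ⊙ u)
  ⊙-assoc (fin a) (fin b) (fin c) = cong fin (+-assoc a b c)
  ⊙-assoc (fin _) (fin _) ∞       = refl
  ⊙-assoc (fin _) ∞       _       = refl
  ⊙-assoc ∞       _       _       = refl

  ⊙-comm : ∀ s t → s ⊙ t ≡ t ⊙ s
  ⊙-comm (fin a) (fin b) = cong fin (+-comm a b)
  ⊙-comm (fin _) ∞       = refl
  ⊙-comm ∞       (fin _) = refl
  ⊙-comm ∞       ∞       = refl

  ⊙-identityˡ : ∀ t → fin 0# ⊙ t ≡ t
  ⊙-identityˡ (fin a) = cong fin (+-identityˡ a)
  ⊙-identityˡ ∞       = refl

  ⊙-commutativeMonoid : CommutativeMonoid 0ℓ 0ℓ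
  ⊙-commutativeMonoid = record
    { isCommutativeMonoid = isCommutativeMonoidˡ record
      { isSemigroup = record { isMagma = ≡-Algebra.isMagma _⊙_ ; assoc = ⊙-assoc }
      ; identityˡ   = ⊙-identityˡ
      ; comm        = ⊙-comm
      }
    }

  open CommutativeMonoid ⊙-commutativeMonoid using () renaming (identityʳ to ⊙-identityʳ)
  open CommutativeSemigroupProperties (CommutativeMonoid.commutativeSemigroup ⊙-commutativeMonoid)
    using () renaming (interchange to ⊙-interchange)
  module 𝕋Σ = MonoidSum ⊙-commutativeMonoid

  tprod≡sum : ∀ {n} (g : Fin n → 𝕋) → tprod g ≡ 𝕋Σ.sum g
  tprod≡sum {zero}  g = refl
  tprod≡sum {suc n} g = cong (g zero ⊙_) (tprod≡sum (g ∘ suc))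

  tprod-cong : ∀ {n} (g h : Fin n → 𝕋) → (∀ v → g v ≡ h v) → tprod g ≡ tprod h
  tprod-cong g h g≗h = trans (tprod≡sum g) (trans (𝕋Σ.sum-cong-≗ g≗h) (sym (tprod≡sum h)))

  tprod-⊙ : ∀ {n} (g h : Fin n → 𝕋) → tprod (λ v → g v ⊙ h v) ≡ tprod g ⊙ tprod h
  tprod-⊙ g h = trans (tprod≡sum (λ v → g v ⊙ h v))
    (trans (𝕋Σ.∑-distrib-+ g h) (sym (cong₂ _⊙_ (tprod≡sum g) (tprod≡sum h))))

  tprod-single : ∀ {n} (g : Fin n → 𝕋) X → (∀ v → v ≢ X → g v ≡ fin 0#) → tprod g ≡ g X
  tprod-single {suc n} g zero g≡0 = trans (cong (g zero ⊙_) rest≡0) (⊙-identityʳ (g zero))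
    where
    rest≡0 : tprod (g ∘ suc) ≡ fin 0#
    rest≡0 = trans (tprod≡sum (g ∘ suc))
      (trans (𝕋Σ.sum-cong-≗ (λ v → g≡0 (suc v) λ ())) (𝕋Σ.sum-replicate-zero n))
  tprod-single {suc n} g (suc X) g≡0 =
    trans (cong (_⊙ tprod (g ∘ suc)) (g≡0 zero λ ()))
      (trans (⊙-identityˡ _) (tprod-single (g ∘ suc) X λ v v≢X → g≡0 (suc v) (v≢X ∘ suc-injective)))

  tpow-+ : ∀ m n t → tpow (m ℕ.+ n) t ≡ tpow m t ⊙ tpow n t
  tpow-+ zero    n t = sym (⊙-identityˡ (tpow n t))
  tpow-+ (suc m) n t = trans (cong (t ⊙_) (tpow-+ m n t)) (sym (⊙-assoc t _ _))

  tprod-δ : ∀ (ν : Vertex → 𝕋) X → tprod (λ v → tpow (δ X v) (ν v)) ≡ ν X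
  tprod-δ ν X = begin
    tprod (λ v → tpow (δ X v) (ν v))
      ≡⟨ tprod-single (λ v → tpow (δ X v) (ν v)) X (λ v v≢X → cong (λ k → tpow k (ν v)) (δ-other v≢X)) ⟩
    tpow (δ X X) (ν X)  ≡⟨ cong (λ k → tpow k (ν X)) (δ-self X) ⟩
    ν X ⊙ fin 0#        ≡⟨ ⊙-identityʳ (ν X) ⟩
    ν X                 ∎
    where open ≡-Reasoning

  tprod-pairExp : ∀ (ν : Vertex → 𝕋) X Y → tprod (λ v → tpow (pairExp X Y v) (ν v)) ≡ ν X ⊙ ν Y
  tprod-pairExp ν X Y = begin
    tprod (λ v → tpow (δ X v ℕ.+ δ Y v) (ν v))
      ≡⟨ tprod-cong (λ v → tpow (δ X v ℕ.+ δ Y v) (ν v)) (λ v → x^ X v ⊙ x^ Y v)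
                    (λ v → tpow-+ (δ X v) (δ Y v) (ν v)) ⟩
    tprod (λ v → x^ X v ⊙ x^ Y v)  ≡⟨ tprod-⊙ (x^ X) (x^ Y) ⟩
    tprod (x^ X) ⊙ tprod (x^ Y)    ≡⟨ cong₂ _⊙_ (tprod-δ ν X) (tprod-δ ν Y) ⟩
    ν X ⊙ ν Y                      ∎
    where
    open ≡-Reasoning
    x^ : Vertex → Vertex → 𝕋
    x^ X v = tpow (δ X v) (ν v)

  monVal-pair : ∀ (f : TropPoly 56) e ν X Y → (∀ v → e v ≡ pairExp X Y v) →
                monVal f e ν ≡ fin (coeff f e) ⊙ (ν X ⊙ ν Y)
  monVal-pair f e ν X Y e≗XY = cong (fin (coeff f e) ⊙_)
    (trans (tprod-cong (λ v → tpow (e v) (ν v)) (λ v → tpow (pairExp X Y v) (ν v))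
                       (λ v → cong (λ k → tpow k (ν v)) (e≗XY v)))
           (tprod-pairExp ν X Y))

  ⊙-fin-mono : ∀ {s t} K → s ≤T t → (s ⊙ fin K) ≤T (t ⊙ fin K)
  ⊙-fin-mono K (fin≤fin a≤b) = fin≤fin (+-mono-≤ K a≤b)
  ⊙-fin-mono K (s ≤∞)        = (s ⊙ fin K) ≤∞

  ⊙-fin-cancel : ∀ t K → (t ⊙ fin K) ⊙ fin (- K) ≡ t
  ⊙-fin-cancel t K = begin
    (t ⊙ fin K) ⊙ fin (- K) ≡⟨ ⊙-assoc t (fin K) (fin (- K)) ⟩
    t ⊙ fin (K + - K)       ≡⟨ cong (λ x → t ⊙ fin x) (-‿inverseʳ K) ⟩
    t ⊙ fin 0#              ≡⟨ ⊙-identityʳ t ⟩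
    t                       ∎
    where open ≡-Reasoning

  UniformShift : ∀ {n} → TropPoly n → (ν ν′ : Fin n → 𝕋) → Carrier → Set
  UniformShift f ν ν′ K = ∀ e → Mon f e → monVal f e ν′ ≡ monVal f e ν ⊙ fin K

  uniformShift-inverse : ∀ {n} {f : TropPoly n} {ν ν′ K} →
                         UniformShift f ν ν′ K → UniformShift f ν′ ν (- K)
  uniformShift-inverse {f = f} {ν} {K = K} shift e m =
    trans (sym (⊙-fin-cancel (monVal f e ν) K)) (cong (_⊙ fin (- K)) (sym (shift e m)))

  uniformShift⇒InVtrop : ∀ {n} {f : TropPoly n} {ν ν′ K} →
                         UniformShift f ν ν′ K → InVtrop f ν → InVtrop f ν′
  uniformShift⇒InVtrop {K = K} shift (inj₁ all∞) =
    inj₁ λ e m → trans (shift e m) (cong (_⊙ fin K) (all∞ e m))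
  uniformShift⇒InVtrop {K = K} shift (inj₂ (e₁ , e₂ , m₁ , m₂ , e₁≢e₂ , tie , minimal)) =
    inj₂ (e₁ , e₂ , m₁ , m₂ , e₁≢e₂ ,
          trans (shift e₁ m₁) (trans (cong (_⊙ fin K) tie) (sym (shift e₂ m₂))) ,
          λ e m → subst₂ _≤T_ (sym (shift e₁ m₁)) (sym (shift e m)) (⊙-fin-mono K (minimal e m)))

  uniformShift⇒InVtrop-⇔ : ∀ {n} {f : TropPoly n} {ν ν′ K} →
                           UniformShift f ν ν′ K → InVtrop f ν ⇔ InVtrop f ν′
  uniformShift⇒InVtrop-⇔ shift =
    mk⇔ (uniformShift⇒InVtrop shift) (uniformShift⇒InVtrop (uniformShift-inverse shift))

  affine : ∀ {n m} → (Fin n → Fin m → Carrier) → (Fin m → Carrier) → Carrier → Fin n → Carrier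
  affine pt a c v = c + rsum (λ j → a j * pt v j)

  affine-+ : ∀ {n m} (pt : Fin n → Fin m → Carrier) a c X Y →
             affine pt a c X + affine pt a c Y ≡ (c + c) + rsum (λ j → a j * (pt X j + pt Y j))
  affine-+ pt a c X Y = begin
    (c + rsum (λ j → a j * pt X j)) + (c + rsum (λ j → a j * pt Y j))
      ≡⟨ +-interchange c _ c _ ⟩
    (c + c) + (rsum (λ j → a j * pt X j) + rsum (λ j → a j * pt Y j))
      ≡⟨ cong (_+_ (c + c)) (sym (rsum-+ (λ j → a j * pt X j) (λ j → a j * pt Y j))) ⟩
    (c + c) + rsum (λ j → a j * pt X j + a j * pt Y j)
      ≡⟨ cong (_+_ (c + c)) (rsum-cong (λ j → sym (distribˡ (a j) (pt X j) (pt Y j)))) ⟩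
    (c + c) + rsum (λ j → a j * (pt X j + pt Y j)) ∎
    where open ≡-Reasoning

  monVal-affShift-pair : ∀ {m} (pt : Vertex → Fin m → Carrier) μ a c (f : TropPoly 56) e X Y →
    (∀ v → e v ≡ pairExp X Y v) →
    monVal f e (affShift pt μ a c) ≡ monVal f e μ ⊙ fin (affine pt a c X + affine pt a c Y)
  monVal-affShift-pair pt μ a c f e X Y e≗XY = begin
    monVal f e (affShift pt μ a c)
      ≡⟨ monVal-pair f e (affShift pt μ a c) X Y e≗XY ⟩
    fin k ⊙ ((μ X ⊙ fin (φ X)) ⊙ (μ Y ⊙ fin (φ Y)))
      ≡⟨ cong (fin k ⊙_) (⊙-interchange (μ X) (fin (φ X)) (μ Y) (fin (φ Y))) ⟩
    fin k ⊙ ((μ X ⊙ μ Y) ⊙ fin (φ X + φ Y))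
      ≡⟨ sym (⊙-assoc (fin k) (μ X ⊙ μ Y) (fin (φ X + φ Y))) ⟩
    (fin k ⊙ (μ X ⊙ μ Y)) ⊙ fin (φ X + φ Y)
      ≡⟨ cong (_⊙ fin (φ X + φ Y)) (sym (monVal-pair f e μ X Y e≗XY)) ⟩
    monVal f e μ ⊙ fin (φ X + φ Y) ∎
    where
    open ≡-Reasoning
    k : Carrier
    k = coeff f e
    φ : Vertex → Carrier
    φ = affine pt a c

  ConstantPairSum : ∀ {m} → (Vertex → Fin m → Carrier) → TropPoly 56 → Set
  ConstantPairSum {m} pt f = Σ[ σ ∈ (Fin m → Carrier) ] ∀ e → Mon f e →
    ∃[ X ] ∃[ Y ] ((∀ v → e v ≡ pairExp X Y v) × (∀ j → pt X j + pt Y j ≡ σ j))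

  constantPairSum⇒uniformShift : ∀ {m} (pt : Vertex → Fin m → Carrier) {f} → ConstantPairSum pt f →
    ∀ μ a c → ∃[ K ] UniformShift f μ (affShift pt μ a c) K
  constantPairSum⇒uniformShift pt {f} (σ , pairs) μ a c = (c + c) + rsum (λ j → a j * σ j) , shift
    where
    shift : UniformShift f μ (affShift pt μ a c) ((c + c) + rsum (λ j → a j * σ j))
    shift e m = let (X , Y , e≗XY , X+Y≡σ) = pairs e m in
      trans (monVal-affShift-pair pt μ a c f e X Y e≗XY)
        (cong (λ x → monVal f e μ ⊙ fin x)
          (trans (affine-+ pt a c X Y) (cong (_+_ (c + c)) (rsum-cong (λ j → cong (a j *_) (X+Y≡σ j))))))

  constantPairSum⇒affinelyInvariant : ∀ {m} (pt : Vertex → Fin m → Carrier) {I} (F : I → TropPoly 56) →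
    (∀ i → ConstantPairSum pt (F i)) → AffinelyInvariant pt F
  constantPairSum⇒affinelyInvariant pt F constant μ a c =
    mk⇔ (λ inV i → Equivalence.to (equiv i) (inV i)) (λ inV i → Equivalence.from (equiv i) (inV i))
    where
    -- Naming ν and ν′ keeps Agda from unfolding InVtrop over 56 variables to infer them.
    equiv : ∀ i → InVtrop (F i) μ ⇔ InVtrop (F i) (affShift pt μ a c)
    equiv i = uniformShift⇒InVtrop-⇔ {f = F i} {ν = μ} {ν′ = affShift pt μ a c}
                (proj₂ (constantPairSum⇒uniformShift pt (constant i) μ a c))

  fromℕ-+ : ∀ m n → fromℕ (m ℕ.+ n) ≡ fromℕ m + fromℕ n
  fromℕ-+ zero    n = sym (+-identityˡ (fromℕ n))
  fromℕ-+ (suc m) n = trans (cong (_+_ 1#) (fromℕ-+ m n)) (sym (+-assoc 1# (fromℕ m) (fromℕ n)))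

  fromℤ-⊖ : ∀ m n → fromℤ (m ⊖ n) ≡ fromℕ m + - fromℕ n
  fromℤ-⊖ zero    zero    = sym (-‿inverseʳ 0#)
  fromℤ-⊖ zero    (suc n) = sym (+-identityˡ (- fromℕ (suc n)))
  fromℤ-⊖ (suc m) zero    = sym (trans (cong (_+_ (fromℕ (suc m))) ε⁻¹≈ε) (+-identityʳ (fromℕ (suc m))))
  fromℤ-⊖ (suc m) (suc n) = begin
    fromℤ (suc m ⊖ suc n)               ≡⟨ cong fromℤ (ℤP.[1+m]⊖[1+n]≡m⊖n m n) ⟩
    fromℤ (m ⊖ n)                       ≡⟨ fromℤ-⊖ m n ⟩
    fromℕ m + - fromℕ n                 ≡⟨ sym (+-identityˡ _) ⟩
    0# + (fromℕ m + - fromℕ n)          ≡⟨ cong (_+ (fromℕ m + - fromℕ n)) (sym (-‿inverseʳ 1#)) ⟩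
    (1# + - 1#) + (fromℕ m + - fromℕ n) ≡⟨ +-interchange 1# (- 1#) (fromℕ m) (- fromℕ n) ⟩
    (1# + fromℕ m) + (- 1# + - fromℕ n) ≡⟨ cong (_+_ (1# + fromℕ m)) (⁻¹-∙-comm 1# (fromℕ n)) ⟩
    (1# + fromℕ m) + - (1# + fromℕ n)   ∎
    where open ≡-Reasoning

  fromℤ-+ : ∀ i j → fromℤ (i ℤ.+ j) ≡ fromℤ i + fromℤ j
  fromℤ-+ (+ m)    (+ n)    = fromℕ-+ m n
  fromℤ-+ (+ m)    -[1+ n ] = fromℤ-⊖ m (suc n)
  fromℤ-+ -[1+ m ] (+ n)    = trans (fromℤ-⊖ n (suc m)) (+-comm (fromℕ n) _)
  fromℤ-+ -[1+ m ] -[1+ n ] = begin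
    - fromℕ (suc (suc (m ℕ.+ n)))     ≡⟨ cong (λ k → - fromℕ (suc k)) (sym (ℕP.+-suc m n)) ⟩
    - fromℕ (suc m ℕ.+ suc n)         ≡⟨ cong -_ (fromℕ-+ (suc m) (suc n)) ⟩
    - (fromℕ (suc m) + fromℕ (suc n)) ≡⟨ sym (⁻¹-∙-comm (fromℕ (suc m)) (fromℕ (suc n))) ⟩
    - fromℕ (suc m) + - fromℕ (suc n) ∎
    where open ≡-Reasoning

  pt-+ : ∀ X Y j {s} → coord X j ℤ.+ coord Y j ≡ s → pt X j + pt Y j ≡ fromℤ s
  pt-+ X Y j X+Y≡s = trans (sym (fromℤ-+ (coord X j) (coord Y j))) (cong fromℤ X+Y≡s)

  family-constantPairSum : ∀ i → ConstantPairSum pt (family i)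
  family-constantPairSum (inj₁ (A , B , d₂)) = (λ j → fromℤ (coord A j ℤ.+ coord B j)) ,
    λ { e (X , Y , antipodal , e≗XY) →
          X , Y , e≗XY , λ j → pt-+ X Y j (antipodalInFace⇒coordSum≡ A B X Y d₂ antipodal j) }
  family-constantPairSum (inj₂ _) = (λ _ → 0#) ,
    λ { e (A , B , d₃ , e≗AB) → A , B , e≗AB , λ j → pt-+ A B j (edgeDist3⇒coordSum≡0 A B d₃ j) }

proposition4p12 : (R : RealField) → Tropical.AffinelyInvariant R (E7.pt R) (E7.family R)
proposition4p12 R = constantPairSum⇒affinelyInvariant R (E7.pt R) (E7.family R) (family-constantPairSum R)
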